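{- Let $p$ be an odd prime and let $\mu$ be the distribution on $\mathbb{F}_p\times\mathbb{F}_p\times\mathbb{F}_p$ of $(x,x+a,x+2a)$, where $x\sim\mathbb{F}_p$ and $a\sim\{0,1,2\}$ are uniform and independent. Then $\mu$ admits no non-trivial Abelian embedding into $(\mathbb{Z},+)$; that is, if $\sigma,\gamma,\phi\colon\mathbb{F}_p\to\mathbb{Z}$ satisfy $\sigma(x)+\gamma(y)+\phi(z)=0$ for all $(x,y,z)\in\mathrm{supp}(\mu)$, then $\sigma,\gamma,\phi$ are all constant. -}

module Defs where

open import Data.Nat using (ℕ; _+_; _*_; _%_; NonZero)
open import Data.Nat.DivMod using (m%n<n)
open import Data.Fin using (Fin; toℕ; fromℕ<)
open import Data.Product using (Σ; _×_; ∃-syntax)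
open import Relation.Binary.PropositionalEquality using (_≡_)

-- The field F_p is modelled by its elements Fin p = {0,…,p-1}
-- with the ring operations taken modulo p.  Only addition is needed.

toFp : (p : ℕ) .{{_ : NonZero p}} → ℕ → Fin p
toFp p n = fromℕ< (m%n<n n p)

_+ₚ_ : {p : ℕ} .{{_ : NonZero p}} → Fin p → Fin p → Fin p
_+ₚ_ {p} x y = toFp p (toℕ x + toℕ y)

-- Support of μ: the distribution of (x, x+a, x+2a) with x uniform on F_p and
-- a uniform on {0,1,2}, independent.  Every such triple has positive
-- probability, so the support is exactly the set of such triples.
InSupp : (p : ℕ) .{{_ : NonZero p}} → Fin p → Fin p → Fin p → Set
InSupp p x y z =
  Σ (Fin p) λ x₀ → Σ (Fin 3) λ a →
    (x ≡ x₀) × (y ≡ x₀ +ₚ toFp p (toℕ a)) × (z ≡ x₀ +ₚ toFp p (2 * toℕ a))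

Constant : {A B : Set} → (A → B) → Set
Constant f = ∀ u v → f u ≡ f v

{-# OPTIONS --safe #-}
module Submission where

-- Read σ, γ, φ as p-periodic functions S, G, Φ on ℕ.  Two constraints whose progressions share
-- their middle term give ΔΦ(n+1) = ΔS(n) and ΔΦ(n+3) = ΔS(n), so ΔS is 2-periodic; as it is also
-- p-periodic with p odd, ΔS is constant, and the constant difference of a periodic function is 0.
-- Thus S is constant, then ΔΦ(n+1) = ΔS(n) = 0 and periodicity make Φ constant, and G = -(S + Φ).

open import Defs
open import Data.Nat as ℕ using (ℕ; NonZero; _%_; _/_; s≤s)
open import Data.Nat.Primality using (Prime; prime⇒irreducible)
open import Data.Fin using (Fin; zero; suc; toℕ)
open import Data.Integer using (ℤ; _+_; 0ℤ; +_; _-_; -_; _*_)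
open import Data.Product using (_×_; _,_)
open import Relation.Binary.PropositionalEquality
  using (_≡_; _≢_; refl; sym; trans; cong; cong₂; subst; module ≡-Reasoning)

open import Data.Fin.Properties using (toℕ<n; toℕ-fromℕ<; fromℕ<-toℕ; fromℕ<-cong)
import Data.Integer.Properties as ℤ
open import Data.Integer.Solver using (module +-*-Solver)
import Data.Nat.Properties as ℕ
open import Data.Nat.DivMod using (m%n<n; m≡m%n+[m/n]*n; %-distribˡ-+; [m+n]%n≡m%n; m<n⇒m%n≡m)
open import Data.Nat.Divisibility using (m%n≡0⇒n∣m)
open import Data.Sum using (inj₁; inj₂)
open import Function using (_∘_)
open import Relation.Nullary using (contradiction)

prime≢2⇒odd : ∀ {p} → Prime p → p ≢ 2 → p ≡ 1 ℕ.+ p / 2 ℕ.* 2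
prime≢2⇒odd {p} pr p≢2 = trans (m≡m%n+[m/n]*n p 2) (cong (ℕ._+ p / 2 ℕ.* 2) p%2≡1)
  where
  p%2≡1 : p % 2 ≡ 1
  p%2≡1 with p % 2 in p%2≡
  ... | 0 with prime⇒irreducible pr (m%n≡0⇒n∣m p 2 p%2≡)
  ...   | inj₁ ()
  ...   | inj₂ 2≡p = contradiction (sym 2≡p) p≢2
  p%2≡1 | 1 = refl
  p%2≡1 | ℕ.suc (ℕ.suc _) with s≤s (s≤s ()) ← subst (ℕ._< 2) p%2≡ (m%n<n p 2)

Periodic : {A : Set} → ℕ → (ℕ → A) → Set
Periodic d f = ∀ n → f (d ℕ.+ n) ≡ f n

module _ {A : Set} {f : ℕ → A} where

  Periodic-* : ∀ {d} → Periodic d f → ∀ k → Periodic (k ℕ.* d) f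
  Periodic-* per ℕ.zero    n = refl
  Periodic-* {d} per (ℕ.suc k) n = begin
    f ((d ℕ.+ k ℕ.* d) ℕ.+ n) ≡⟨ cong f (ℕ.+-assoc d (k ℕ.* d) n) ⟩
    f (d ℕ.+ (k ℕ.* d ℕ.+ n)) ≡⟨ per (k ℕ.* d ℕ.+ n) ⟩
    f (k ℕ.* d ℕ.+ n)         ≡⟨ Periodic-* per k n ⟩
    f n                       ∎
    where open ≡-Reasoning

  Periodic-2∧Periodic-odd⇒Periodic-1 : ∀ q → Periodic 2 f → Periodic (1 ℕ.+ q ℕ.* 2) f → Periodic 1 f
  Periodic-2∧Periodic-odd⇒Periodic-1 q per₂ per-odd n = begin
    f (1 ℕ.+ n)                 ≡⟨ Periodic-* per₂ q (1 ℕ.+ n) ⟨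
    f (q ℕ.* 2 ℕ.+ (1 ℕ.+ n))   ≡⟨ cong f (ℕ.+-suc (q ℕ.* 2) n) ⟩
    f ((1 ℕ.+ q ℕ.* 2) ℕ.+ n)   ≡⟨ per-odd n ⟩
    f n                         ∎
    where open ≡-Reasoning

  Periodic-1⇒Constant : Periodic 1 f → Constant f
  Periodic-1⇒Constant per u v = trans (≡f0 u) (sym (≡f0 v))
    where
    ≡f0 : ∀ n → f n ≡ f 0
    ≡f0 ℕ.zero    = refl
    ≡f0 (ℕ.suc n) = trans (per n) (≡f0 n)

Δ : (ℕ → ℤ) → ℕ → ℤ
Δ f n = f (ℕ.suc n) - f n

Periodic-Δ : ∀ {d f} → Periodic d f → Periodic d (Δ f)
Periodic-Δ {d} {f} per n =
  cong₂ _-_ (trans (cong f (sym (ℕ.+-suc d n))) (per (ℕ.suc n))) (per n)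

Δ≡c⇒f[k+n]≡k*c+f[n] : ∀ {f c} → (∀ n → Δ f n ≡ c) → ∀ k n → f (k ℕ.+ n) ≡ + k * c + f n
Δ≡c⇒f[k+n]≡k*c+f[n] {f} {c} Δf≡c ℕ.zero n = sym (trans (cong (_+ f n) (ℤ.*-zeroˡ c)) (ℤ.+-identityˡ (f n)))
Δ≡c⇒f[k+n]≡k*c+f[n] {f} {c} Δf≡c (ℕ.suc k) n = begin
  f (ℕ.suc (k ℕ.+ n))              ≡⟨ solve 2 (λ x y → x := (x :- y) :+ y) refl
                                              (f (ℕ.suc (k ℕ.+ n))) (f (k ℕ.+ n)) ⟩
  Δ f (k ℕ.+ n) + f (k ℕ.+ n)      ≡⟨ cong₂ _+_ (Δf≡c (k ℕ.+ n))
                                                (Δ≡c⇒f[k+n]≡k*c+f[n] {f = f} Δf≡c k n) ⟩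
  c + (+ k * c + f n)              ≡⟨ ℤ.+-assoc c (+ k * c) (f n) ⟨
  c + + k * c + f n                ≡⟨ cong (_+ f n) (ℤ.suc-* (+ k) c) ⟨
  + ℕ.suc k * c + f n              ∎
  where
  open ≡-Reasoning
  open +-*-Solver

Periodic∧Δ≡c⇒c≡0 : ∀ {d} .{{_ : NonZero d}} {f c} → Periodic d f → (∀ n → Δ f n ≡ c) → c ≡ 0ℤ
Periodic∧Δ≡c⇒c≡0 {d} {f} {c} per Δf≡c = ℤ.*-cancelˡ-≡ (+ d) c 0ℤ (begin
  + d * c                       ≡⟨ ℤ.+-identityʳ (+ d * c) ⟨
  + d * c + 0ℤ                  ≡⟨ cong (λ x → + d * c + x) (ℤ.+-inverseʳ (f 0)) ⟨
  + d * c + (f 0 - f 0)         ≡⟨ ℤ.+-assoc (+ d * c) (f 0) (- f 0) ⟨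
  + d * c + f 0 - f 0           ≡⟨ cong (_- f 0) (Δ≡c⇒f[k+n]≡k*c+f[n] {f = f} Δf≡c d 0) ⟨
  f (d ℕ.+ 0) - f 0             ≡⟨ ℤ.i≡j⇒i-j≡0 (per 0) ⟩
  0ℤ                            ≡⟨ ℤ.*-zeroʳ (+ d) ⟨
  + d * 0ℤ                      ∎)
  where open ≡-Reasoning

Periodic-odd∧Periodic-2-Δ⇒Constant : ∀ q {f} → Periodic (1 ℕ.+ q ℕ.* 2) f → Periodic 2 (Δ f) → Constant f
Periodic-odd∧Periodic-2-Δ⇒Constant q {f} per Δper₂ =
  Periodic-1⇒Constant (λ n → ℤ.i-j≡0⇒i≡j _ _ (Δf≡0 n))
  where
  Δf-constant : Constant (Δ f)
  Δf-constant = Periodic-1⇒Constant (Periodic-2∧Periodic-odd⇒Periodic-1 q Δper₂ (Periodic-Δ {f = f} per))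

  Δf≡0 : ∀ n → Δ f n ≡ 0ℤ
  Δf≡0 n = trans (Δf-constant n 0) (Periodic∧Δ≡c⇒c≡0 {f = f} per (λ m → Δf-constant m 0))

x+y+z≡x′+y+z′⇒z-z′≡x′-x : ∀ x y z x′ z′ → x + y + z ≡ x′ + y + z′ → z - z′ ≡ x′ - x
x+y+z≡x′+y+z′⇒z-z′≡x′-x x y z x′ z′ eq = ℤ.i-j≡0⇒i≡j _ _ (begin
  (z - z′) - (x′ - x)               ≡⟨ solve 5 (λ x y z x′ z′ →
                                               (z :- z′) :- (x′ :- x) := (x :+ y :+ z) :- (x′ :+ y :+ z′))
                                             refl x y z x′ z′ ⟩
  (x + y + z) - (x′ + y + z′)       ≡⟨ ℤ.i≡j⇒i-j≡0 eq ⟩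
  0ℤ                                ∎)
  where
  open ≡-Reasoning
  open +-*-Solver

x+y+z≡0⇒y≡-[x+z] : ∀ x y z → x + y + z ≡ 0ℤ → y ≡ - (x + z)
x+y+z≡0⇒y≡-[x+z] x y z eq = begin
  y                           ≡⟨ solve 3 (λ x y z → y := (x :+ y :+ z) :- (x :+ z)) refl x y z ⟩
  (x + y + z) - (x + z)       ≡⟨ cong (_- (x + z)) eq ⟩
  0ℤ - (x + z)                ≡⟨ ℤ.+-identityˡ (- (x + z)) ⟩
  - (x + z)                   ∎
  where
  open ≡-Reasoning
  open +-*-Solver

Balanced : (S G Φ : ℕ → ℤ) → ℕ → Set
Balanced S G Φ a = ∀ n → S n + G (a ℕ.+ n) + Φ (2 ℕ.* a ℕ.+ n) ≡ 0ℤ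

balanced⇒Constant : ∀ q {S G Φ} → Periodic (1 ℕ.+ q ℕ.* 2) S → Periodic (1 ℕ.+ q ℕ.* 2) Φ →
                    Balanced S G Φ 0 → Balanced S G Φ 1 → Balanced S G Φ 2 →
                    Constant S × Constant G × Constant Φ
balanced⇒Constant q {S} {G} {Φ} S-per Φ-per E₀ E₁ E₂ = S-constant , G-constant , Φ-constant
  where
  ΔΦ[1+n]≡ΔS[n] : ∀ n → Δ Φ (1 ℕ.+ n) ≡ Δ S n
  ΔΦ[1+n]≡ΔS[n] n =
    x+y+z≡x′+y+z′⇒z-z′≡x′-x (S n) (G (1 ℕ.+ n)) (Φ (2 ℕ.+ n)) (S (1 ℕ.+ n)) (Φ (1 ℕ.+ n))
      (trans (E₁ n) (sym (E₀ (1 ℕ.+ n))))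

  ΔΦ[3+n]≡ΔS[n] : ∀ n → Δ Φ (3 ℕ.+ n) ≡ Δ S n
  ΔΦ[3+n]≡ΔS[n] n =
    x+y+z≡x′+y+z′⇒z-z′≡x′-x (S n) (G (2 ℕ.+ n)) (Φ (4 ℕ.+ n)) (S (1 ℕ.+ n)) (Φ (3 ℕ.+ n))
      (trans (E₂ n) (sym (E₁ (1 ℕ.+ n))))

  S-constant : Constant S
  S-constant = Periodic-odd∧Periodic-2-Δ⇒Constant q S-per
    (λ n → trans (sym (ΔΦ[1+n]≡ΔS[n] (2 ℕ.+ n))) (ΔΦ[3+n]≡ΔS[n] n))

  Φ∘suc-constant : Constant (Φ ∘ ℕ.suc)
  Φ∘suc-constant = Periodic-1⇒Constant λ n →
    ℤ.i-j≡0⇒i≡j _ _ (trans (ΔΦ[1+n]≡ΔS[n] n) (ℤ.i≡j⇒i-j≡0 (S-constant (ℕ.suc n) n)))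

  Φ-constant : Constant Φ
  Φ-constant u v = trans (sym (Φ-per u)) (trans (Φ∘suc-constant _ _) (Φ-per v))

  G-constant : Constant G
  G-constant u v = begin
    G u               ≡⟨ x+y+z≡0⇒y≡-[x+z] (S u) (G u) (Φ u) (E₀ u) ⟩
    - (S u + Φ u)     ≡⟨ cong -_ (cong₂ _+_ (S-constant u v) (Φ-constant u v)) ⟩
    - (S v + Φ v)     ≡⟨ x+y+z≡0⇒y≡-[x+z] (S v) (G v) (Φ v) (E₀ v) ⟨
    G v               ∎
    where open ≡-Reasoning

module _ {p : ℕ} .{{_ : NonZero p}} where

  toFp-+ : ∀ m n → toFp p m +ₚ toFp p n ≡ toFp p (m ℕ.+ n)
  toFp-+ m n = fromℕ<-cong _ _ (begin
    (toℕ (toFp p m) ℕ.+ toℕ (toFp p n)) % p   ≡⟨ cong₂ (λ i j → (i ℕ.+ j) % p)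
                                                       (toℕ-fromℕ< (m%n<n m p)) (toℕ-fromℕ< (m%n<n n p)) ⟩
    (m % p ℕ.+ n % p) % p                     ≡⟨ %-distribˡ-+ m n p ⟨
    (m ℕ.+ n) % p                             ∎) _ _
    where open ≡-Reasoning

  toFp-toℕ : ∀ x → toFp p (toℕ x) ≡ x
  toFp-toℕ x = trans (fromℕ<-cong _ _ (m<n⇒m%n≡m (toℕ<n x)) _ (toℕ<n x)) (fromℕ<-toℕ x (toℕ<n x))

  Periodic-toFp : Periodic p (toFp p)
  Periodic-toFp n = fromℕ<-cong _ _ (trans (cong (_% p) (ℕ.+-comm p n)) ([m+n]%n≡m%n n p)) _ _

  progression∈InSupp : ∀ n (a : Fin 3) → InSupp p (toFp p n) (toFp p (toℕ a ℕ.+ n)) (toFp p (2 ℕ.* toℕ a ℕ.+ n))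
  progression∈InSupp n a = toFp p n , a , refl , shifted (toℕ a) , shifted (2 ℕ.* toℕ a)
    where
    shifted : ∀ k → toFp p (k ℕ.+ n) ≡ toFp p n +ₚ toFp p k
    shifted k = trans (cong (toFp p) (ℕ.+-comm k n)) (sym (toFp-+ n k))

  Constant-∘toFp⇒Constant : {A : Set} {f : Fin p → A} → Constant (f ∘ toFp p) → Constant f
  Constant-∘toFp⇒Constant {f = f} f∘toFp-constant u v = begin
    f u                 ≡⟨ cong f (toFp-toℕ u) ⟨
    f (toFp p (toℕ u))  ≡⟨ f∘toFp-constant (toℕ u) (toℕ v) ⟩
    f (toFp p (toℕ v))  ≡⟨ cong f (toFp-toℕ v) ⟩
    f v                 ∎
    where open ≡-Reasoning

claim4p2 : (p : ℕ) .{{_ : NonZero p}} → Prime p → p ≢ 2 →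
    (σ γ φ : Fin p → ℤ) →
    (∀ x y z → InSupp p x y z → σ x + γ y + φ z ≡ 0ℤ) →
    Constant σ × Constant γ × Constant φ
claim4p2 p pr p≢2 σ γ φ H =
  let σ-constant , γ-constant , φ-constant = balanced⇒Constant (p / 2) (periodic σ) (periodic φ)
                                               (balanced zero) (balanced (suc zero)) (balanced (suc (suc zero)))
  in Constant-∘toFp⇒Constant σ-constant , Constant-∘toFp⇒Constant γ-constant , Constant-∘toFp⇒Constant φ-constant
  where
  periodic : (f : Fin p → ℤ) → Periodic (1 ℕ.+ p / 2 ℕ.* 2) (f ∘ toFp p)
  periodic f = subst (λ d → Periodic d (f ∘ toFp p)) (prime≢2⇒odd pr p≢2) (cong f ∘ Periodic-toFp)

  balanced : (a : Fin 3) → Balanced (σ ∘ toFp p) (γ ∘ toFp p) (φ ∘ toFp p) (toℕ a)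
  balanced a n = H _ _ _ (progression∈InSupp n a)
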